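{- Let $G=\mathbb{Z}_n$, $x\in G$, and $1\le k\le n$. Let $q$ be the largest prime factor of $n$ and $t=\nu_q(n)$. If $n\le q^{2t}-1$ and $\gcd(k,n)=1$, then $(G,\mathcal{B}_k^x)$ is not a $1$-design.
   Context: $\mathcal{B}_k^x$ is the family of all $k$-subsets of $\mathbb{Z}_n$ whose elements sum to $x$; $(G,\mathcal{B}_k^x)$ is a $1$-design if every element of $G$ lies in the same number of these subsets. $\nu_q$ is the $q$-adic valuation. -}

module Defs where

open import Data.Nat using (ℕ; zero; suc; _+_; _%_; NonZero)
open import Data.Nat.Properties using (_≟_)
open import Data.Fin using (Fin; toℕ)
open import Data.Fin.Subset using (Subset; _∈_; ∣_∣; inside; outside)
open import Data.Fin.Subset.Properties using (_∈?_)
open import Data.List using (List; []; _∷_; map; filter; length; allFin; _++_)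
open import Data.Vec using (_∷_; [])
open import Data.Product using (_×_)
open import Data.Nat.ListAction using (sum)
open import Relation.Nullary.Decidable using (_×-dec_)
open import Relation.Binary.PropositionalEquality using (_≡_)

allSubsets : ∀ n → List (Subset n)
allSubsets zero    = [] ∷ []
allSubsets (suc n) = map (outside ∷_) (allSubsets n) ++ map (inside ∷_) (allSubsets n)

elemSum : ∀ {n} → Subset n → ℕ
elemSum {n} S = sum (map toℕ (filter (_∈? S) (allFin n)))

IsBlock : (n : ℕ) .{{_ : NonZero n}} → ℕ → Fin n → Subset n → Set
IsBlock n k x S = (∣ S ∣ ≡ k) × (elemSum S % n ≡ toℕ x)

B : (n : ℕ) .{{_ : NonZero n}} → ℕ → Fin n → List (Subset n)
B n k x = filter (λ S → (∣ S ∣ ≟ k) ×-dec (elemSum S % n ≟ toℕ x)) (allSubsets n)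

replication : (n : ℕ) .{{_ : NonZero n}} → ℕ → Fin n → Fin n → ℕ
replication n k x g = length (filter (g ∈?_) (B n k x))

Is1Design : (n : ℕ) .{{_ : NonZero n}} → ℕ → Fin n → Set
Is1Design n k x = ∀ g h → replication n k x g ≡ replication n k x h

-- If every point of ℤ_n lies in r blocks, counting point–block incidences gives n r = k |B_k^x|, so
-- n ∣ |B_k^x| because gcd(k, n) = 1. Rotating a k-subset of ℤ_n by one adds k to its element sum, and
-- k generates ℤ_n, so the n families B_k^y all have the same size; hence C(n, k) = n |B_k^x| is
-- divisible by n², in particular by q^(2t). But a prime power dividing C(n, k) is at most n: by
-- Kummer each factor q comes from a base-q carry in k + (n − k), and there are fewer carries than
-- digits. This contradicts n < q^(2t).
{-# OPTIONS --safe #-}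
module Submission where

open import Defs
open import Data.Bool.Base using (Bool; true; false; _∧_)
open import Data.Empty using (⊥-elim)
open import Data.Fin using (Fin; toℕ; zero; suc)
open import Data.Fin.Properties using (toℕ<n)
open import Data.Fin.Subset using (Subset; ∣_∣; inside; outside)
open import Data.Fin.Subset.Properties using (_∈?_)
open import Data.List using (List; []; _∷_; map; filter; length; allFin; _++_; downFrom)
open import Data.List.Properties using (map-cong; map-++; map-∘; map-tabulate; length-tabulate; length-downFrom)
open import Data.List.Relation.Unary.All as All using (All; []; _∷_)
open import Data.List.Relation.Unary.All.Properties using (all-filter)
open import Data.Nat
open import Data.Nat.Properties
open import Algebra.Properties.CommutativeSemigroup +-commutativeSemigroup using (interchange; x∙yz≈y∙xz)
open import Data.Nat.Combinatorics using (_C_; nCk≡n!/k![n-k]!; k![n∸k]!∣n!; nCk+nC[k+1]≡[n+1]C[k+1])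
open import Data.Nat.Coprimality using (Coprime; coprime-Bézout; coprime-divisor; gcd≡1⇒coprime)
  renaming (sym to coprime-sym)
open import Data.Nat.DivMod
  using (%-distribˡ-+; [m+kn]%n≡m%n; m<n⇒m%n≡m; m%n<n; m≡m%n+[m/n]*n; m<n*o⇒m/o<n; m/n*n≡m)
open import Data.Nat.Divisibility using (_∣_; divides; ∣-trans; *-monoʳ-∣; *-monoˡ-∣; *-pres-∣;
  *-cancelˡ-∣; ∣⇒≤; ∣1⇒≡1; ∣m+n∣m⇒∣n; n∣m*n; m∣m*n; ∣m⇒∣m*n)
open import Data.Nat.GCD using (gcd; module Bézout)
open import Data.Nat.Induction using (<-wellFounded)
open import Data.Nat.ListAction using (sum)
open import Data.Nat.ListAction.Properties using (sum-++)
open import Data.Nat.Primality using (Prime; euclidsLemma; prime⇒nonZero; prime⇒nonTrivial)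
open import Data.Nat.Tactic.RingSolver using (solve-∀)
open import Data.Product using (∃-syntax; _×_; _,_; proj₁)
open import Data.Sum using (_⊎_; inj₁; inj₂; [_,_]′; map₂)
open import Data.Vec using (_∷ʳ_; []; _∷_)
open import Function using (_∘_; id)
open import Function.Bundles using (_⇔_; mk⇔)
open import Induction.WellFounded using (Acc; acc)
open import Level using (Level)
open import Relation.Binary.Definitions using (tri<; tri≈; tri>)
open import Relation.Binary.PropositionalEquality
open import Relation.Nullary using (Dec; does; ¬_)
open import Relation.Nullary.Decidable using (_×-dec_; does-⇔; dec-true; dec-false)
open import Relation.Unary using (Decidable)

private variable
  ℓ : Level
  X Y : Set ℓ
  P Q : Set ℓ

-- Sums over lists

bit : Bool → ℕ
bit false = 0
bit true  = 1

bit-∧ : ∀ x y → bit (x ∧ y) ≡ bit x * bit y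
bit-∧ false y = refl
bit-∧ true  y = sym (+-identityʳ (bit y))

𝟙 : Dec P → ℕ
𝟙 P? = bit (does P?)

𝟙-⇔ : (P? : Dec P) (Q? : Dec Q) → P ⇔ Q → 𝟙 P? ≡ 𝟙 Q?
𝟙-⇔ P? Q? P⇔Q = cong bit (does-⇔ P⇔Q P? Q?)

𝟙-×-dec : (P? : Dec P) (Q? : Dec Q) → 𝟙 (P? ×-dec Q?) ≡ 𝟙 P? * 𝟙 Q?
𝟙-×-dec P? Q? = bit-∧ (does P?) (does Q?)

∑ : List X → (X → ℕ) → ℕ
∑ xs f = sum (map f xs)

∑-cong : ∀ (xs : List X) {f g} → (∀ x → f x ≡ g x) → ∑ xs f ≡ ∑ xs g
∑-cong xs f≗g = cong sum (map-cong f≗g xs)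

∑-++ : ∀ (xs ys : List X) f → ∑ (xs ++ ys) f ≡ ∑ xs f + ∑ ys f
∑-++ xs ys f = trans (cong sum (map-++ f xs ys)) (sum-++ (map f xs) (map f ys))

∑-map : ∀ (g : Y → X) xs f → ∑ (map g xs) f ≡ ∑ xs (f ∘ g)
∑-map g xs f = cong sum (sym (map-∘ xs))

∑-+ : ∀ (xs : List X) f g → ∑ xs (λ x → f x + g x) ≡ ∑ xs f + ∑ xs g
∑-+ []       f g = refl
∑-+ (x ∷ xs) f g = trans (cong (f x + g x +_) (∑-+ xs f g)) (interchange (f x) (g x) (∑ xs f) (∑ xs g))

∑-*ˡ : ∀ (xs : List X) c f → ∑ xs (λ x → c * f x) ≡ c * ∑ xs f
∑-*ˡ []       c f = sym (*-zeroʳ c)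
∑-*ˡ (x ∷ xs) c f = trans (cong (c * f x +_) (∑-*ˡ xs c f)) (sym (*-distribˡ-+ c (f x) (∑ xs f)))

∑-All≡ : ∀ {xs : List X} {f : X → ℕ} {c} → All (λ x → f x ≡ c) xs → ∑ xs f ≡ length xs * c
∑-All≡ []           = refl
∑-All≡ (fx≡c ∷ all) = cong₂ _+_ fx≡c (∑-All≡ all)

∑-const : ∀ (xs : List X) c → ∑ xs (λ _ → c) ≡ length xs * c
∑-const xs c = ∑-All≡ (All.universal (λ _ → refl) xs)

∑-comm : ∀ (xs : List X) (ys : List Y) (f : X → Y → ℕ) → ∑ xs (λ x → ∑ ys (f x)) ≡ ∑ ys (λ y → ∑ xs (λ x → f x y))
∑-comm []       ys f = sym (trans (∑-const ys 0) (*-zeroʳ (length ys)))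
∑-comm (x ∷ xs) ys f = trans (cong (∑ ys (f x) +_) (∑-comm xs ys f)) (sym (∑-+ ys (f x) _))

length-filter≡∑𝟙 : ∀ {P : X → Set ℓ} (P? : Decidable P) xs → length (filter P? xs) ≡ ∑ xs (𝟙 ∘ P?)
length-filter≡∑𝟙 P? []       = refl
length-filter≡∑𝟙 P? (x ∷ xs) with does (P? x)
... | true  = cong suc (length-filter≡∑𝟙 P? xs)
... | false = length-filter≡∑𝟙 P? xs

sum-filter≡∑𝟙* : ∀ {P : X → Set ℓ} (P? : Decidable P) xs f → sum (map f (filter P? xs)) ≡ ∑ xs (λ x → 𝟙 (P? x) * f x)
sum-filter≡∑𝟙* P? []       f = refl
sum-filter≡∑𝟙* P? (x ∷ xs) f with does (P? x)
... | true  = cong₂ _+_ (sym (+-identityʳ (f x))) (sum-filter≡∑𝟙* P? xs f)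
... | false = sum-filter≡∑𝟙* P? xs f

∑-allSubsets-∷ : ∀ m (f : Subset (suc m) → ℕ) →
                 ∑ (allSubsets (suc m)) f ≡ ∑ (allSubsets m) (f ∘ (outside ∷_)) + ∑ (allSubsets m) (f ∘ (inside ∷_))
∑-allSubsets-∷ m f = trans (∑-++ (map (outside ∷_) (allSubsets m)) _ f)
                           (cong₂ _+_ (∑-map _ (allSubsets m) f) (∑-map _ (allSubsets m) f))

∑-allSubsets-∷ʳ : ∀ m (f : Subset (suc m) → ℕ) →
                  ∑ (allSubsets (suc m)) f ≡ ∑ (allSubsets m) (λ v → f (v ∷ʳ outside) + f (v ∷ʳ inside))
∑-allSubsets-∷ʳ zero    f = sym (+-assoc (f (outside ∷ [])) (f (inside ∷ [])) 0)
∑-allSubsets-∷ʳ (suc m) f = begin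
  ∑ (allSubsets (2+ m)) f
    ≡⟨ ∑-allSubsets-∷ (suc m) f ⟩
  ∑ (allSubsets (suc m)) (f ∘ (outside ∷_)) + ∑ (allSubsets (suc m)) (f ∘ (inside ∷_))
    ≡⟨ cong₂ _+_ (∑-allSubsets-∷ʳ m (f ∘ (outside ∷_))) (∑-allSubsets-∷ʳ m (f ∘ (inside ∷_))) ⟩
  ∑ (allSubsets m) (λ v → f (outside ∷ (v ∷ʳ outside)) + f (outside ∷ (v ∷ʳ inside))) +
  ∑ (allSubsets m) (λ v → f (inside ∷ (v ∷ʳ outside)) + f (inside ∷ (v ∷ʳ inside)))
    ≡⟨ ∑-allSubsets-∷ m (λ v → f (v ∷ʳ outside) + f (v ∷ʳ inside)) ⟨
  ∑ (allSubsets (suc m)) (λ v → f (v ∷ʳ outside) + f (v ∷ʳ inside)) ∎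
  where open ≡-Reasoning

∣∷∣ : ∀ {m} b (v : Subset m) → ∣ b ∷ v ∣ ≡ bit b + ∣ v ∣
∣∷∣ false v = refl
∣∷∣ true  v = refl

∣∷ʳ∣ : ∀ {m} (v : Subset m) b → ∣ v ∷ʳ b ∣ ≡ bit b + ∣ v ∣
∣∷ʳ∣ []      b = ∣∷∣ b []
∣∷ʳ∣ (c ∷ v) b = begin
  ∣ c ∷ (v ∷ʳ b) ∣       ≡⟨ ∣∷∣ c (v ∷ʳ b) ⟩
  bit c + ∣ v ∷ʳ b ∣      ≡⟨ cong (bit c +_) (∣∷ʳ∣ v b) ⟩
  bit c + (bit b + ∣ v ∣) ≡⟨ x∙yz≈y∙xz (bit c) (bit b) ∣ v ∣ ⟩
  bit b + (bit c + ∣ v ∣) ≡⟨ cong (bit b +_) (∣∷∣ c v) ⟨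
  bit b + ∣ c ∷ v ∣      ∎
  where open ≡-Reasoning

∑𝟙[∣S∣≟k]≡nCk : ∀ n k → ∑ (allSubsets n) (λ S → 𝟙 (∣ S ∣ ≟ k)) ≡ n C k
∑𝟙[∣S∣≟k]≡nCk zero    zero    = refl
∑𝟙[∣S∣≟k]≡nCk zero    (suc k) = refl
∑𝟙[∣S∣≟k]≡nCk (suc n) k = trans (∑-allSubsets-∷ n (λ S → 𝟙 (∣ S ∣ ≟ k))) (split k)
  where
  split : ∀ k → ∑ (allSubsets n) (λ v → 𝟙 (∣ v ∣ ≟ k)) + ∑ (allSubsets n) (λ v → 𝟙 (suc ∣ v ∣ ≟ k)) ≡ suc n C k
  split zero    = cong₂ _+_ (∑𝟙[∣S∣≟k]≡nCk n 0) (trans (∑-const (allSubsets n) 0) (*-zeroʳ (length (allSubsets n))))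
  split (suc k) = trans (cong₂ _+_ (∑𝟙[∣S∣≟k]≡nCk n (suc k)) (∑𝟙[∣S∣≟k]≡nCk n k))
                        (trans (+-comm (n C suc k) (n C k)) (nCk+nC[k+1]≡[n+1]C[k+1] n k))

∑-allFin-suc : ∀ m (f : Fin (suc m) → ℕ) → ∑ (allFin (suc m)) f ≡ f zero + ∑ (allFin m) (f ∘ suc)
∑-allFin-suc m f = cong (f zero +_) (trans (cong sum (map-tabulate suc f)) (sym (cong sum (map-tabulate id (f ∘ suc)))))

∣S∣≡∑𝟙[i∈S] : ∀ {n} (S : Subset n) → ∣ S ∣ ≡ ∑ (allFin n) (λ i → 𝟙 (i ∈? S))
∣S∣≡∑𝟙[i∈S] [] = refl
∣S∣≡∑𝟙[i∈S] {suc m} (b ∷ v) =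
  trans (∣∷∣ b v) (trans (cong₂ _+_ (bit≡𝟙[0∈] b) (∣S∣≡∑𝟙[i∈S] v)) (sym (∑-allFin-suc m _)))
  where
  bit≡𝟙[0∈] : ∀ b → bit b ≡ 𝟙 (zero ∈? (b ∷ v))
  bit≡𝟙[0∈] false = refl
  bit≡𝟙[0∈] true  = refl

elemSum≡∑ : ∀ {n} (S : Subset n) → elemSum S ≡ ∑ (allFin n) (λ i → 𝟙 (i ∈? S) * toℕ i)
elemSum≡∑ {n} S = sum-filter≡∑𝟙* (_∈? S) (allFin n) toℕ

elemSum-∷ : ∀ {m} b (v : Subset m) → elemSum (b ∷ v) ≡ elemSum v + ∣ v ∣
elemSum-∷ {m} b v = begin
  elemSum (b ∷ v)
    ≡⟨ elemSum≡∑ (b ∷ v) ⟩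
  ∑ (allFin (suc m)) (λ i → 𝟙 (i ∈? (b ∷ v)) * toℕ i)
    ≡⟨ ∑-allFin-suc m _ ⟩
  𝟙 (zero ∈? (b ∷ v)) * 0 + ∑ (allFin m) (λ i → 𝟙 (i ∈? v) * suc (toℕ i))
    ≡⟨ cong₂ _+_ (*-zeroʳ (𝟙 (zero ∈? (b ∷ v)))) (∑-cong (allFin m) (λ i → *-suc′ (𝟙 (i ∈? v)) (toℕ i))) ⟩
  ∑ (allFin m) (λ i → 𝟙 (i ∈? v) * toℕ i + 𝟙 (i ∈? v))
    ≡⟨ ∑-+ (allFin m) _ _ ⟩
  ∑ (allFin m) (λ i → 𝟙 (i ∈? v) * toℕ i) + ∑ (allFin m) (λ i → 𝟙 (i ∈? v))
    ≡⟨ cong₂ _+_ (elemSum≡∑ v) (∣S∣≡∑𝟙[i∈S] v) ⟨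
  elemSum v + ∣ v ∣ ∎
  where
  open ≡-Reasoning
  *-suc′ : ∀ x y → x * suc y ≡ x * y + x
  *-suc′ = solve-∀

private
  snoc-regroup : ∀ s x m c → s + x * m + (x + c) ≡ s + c + x * suc m
  snoc-regroup = solve-∀

elemSum-∷ʳ : ∀ {m} (v : Subset m) b → elemSum (v ∷ʳ b) ≡ elemSum v + bit b * m
elemSum-∷ʳ []             false = refl
elemSum-∷ʳ []             true  = refl
elemSum-∷ʳ {suc m} (c ∷ v) b = begin
  elemSum (c ∷ (v ∷ʳ b))                         ≡⟨ elemSum-∷ c (v ∷ʳ b) ⟩
  elemSum (v ∷ʳ b) + ∣ v ∷ʳ b ∣                   ≡⟨ cong₂ _+_ (elemSum-∷ʳ v b) (∣∷ʳ∣ v b) ⟩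
  elemSum v + bit b * m + (bit b + ∣ v ∣)         ≡⟨ snoc-regroup (elemSum v) (bit b) m ∣ v ∣ ⟩
  elemSum v + ∣ v ∣ + bit b * suc m               ≡⟨ cong (_+ bit b * suc m) (elemSum-∷ c v) ⟨
  elemSum (c ∷ v) + bit b * suc m                 ∎
  where open ≡-Reasoning

-- Rotating v ∷ʳ b to b ∷ v adds 1 to every element, the last one wrapping round to 0.
elemSum-rotate : ∀ {m} (v : Subset m) b → elemSum (v ∷ʳ b) + ∣ v ∷ʳ b ∣ ≡ elemSum (b ∷ v) + bit b * suc m
elemSum-rotate v b = begin
  elemSum (v ∷ʳ b) + ∣ v ∷ʳ b ∣              ≡⟨ cong₂ _+_ (elemSum-∷ʳ v b) (∣∷ʳ∣ v b) ⟩
  elemSum v + bit b * _ + (bit b + ∣ v ∣)    ≡⟨ snoc-regroup (elemSum v) (bit b) _ ∣ v ∣ ⟩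
  elemSum v + ∣ v ∣ + bit b * suc _          ≡⟨ cong (_+ bit b * suc _) (elemSum-∷ b v) ⟨
  elemSum (b ∷ v) + bit b * suc _            ∎
  where open ≡-Reasoning

-- Residue classes of k-subsets and 1-designs

+-congʳ-mod : ∀ a b c n .{{_ : NonZero n}} → a % n ≡ b % n → (a + c) % n ≡ (b + c) % n
+-congʳ-mod a b c n a≡b = begin
  (a + c) % n               ≡⟨ %-distribˡ-+ a c n ⟩
  (a % n + c % n) % n       ≡⟨ cong (λ x → (x + c % n) % n) a≡b ⟩
  (b % n + c % n) % n       ≡⟨ %-distribˡ-+ b c n ⟨
  (b + c) % n               ∎
  where open ≡-Reasoning

+-cancelʳ-mod : ∀ a b c m → (a + c) % suc m ≡ (b + c) % suc m → a % suc m ≡ b % suc m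
+-cancelʳ-mod a b c m a+c≡b+c = begin
  a % suc m                  ≡⟨ [m+kn]%n≡m%n a c (suc m) ⟨
  (a + c * suc m) % suc m    ≡⟨ cong (_% suc m) (add-c*m a) ⟩
  (a + c + c * m) % suc m    ≡⟨ +-congʳ-mod (a + c) (b + c) (c * m) (suc m) a+c≡b+c ⟩
  (b + c + c * m) % suc m    ≡⟨ cong (_% suc m) (add-c*m b) ⟨
  (b + c * suc m) % suc m    ≡⟨ [m+kn]%n≡m%n b c (suc m) ⟩
  b % suc m                  ∎
  where
  open ≡-Reasoning
  add-c*m : ∀ x → x + c * suc m ≡ x + c + c * m
  add-c*m x = trans (cong (x +_) (*-suc c m)) (sym (+-assoc x c (c * m)))

𝟙[≟]+𝟙[<?]≡𝟙[<?suc] : ∀ r j → 𝟙 (r ≟ j) + 𝟙 (r <? j) ≡ 𝟙 (r <? suc j)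
𝟙[≟]+𝟙[<?]≡𝟙[<?suc] r j with <-cmp r j
... | tri< r<j r≢j _
  rewrite dec-false (r ≟ j) r≢j | dec-true (r <? j) r<j | dec-true (r <? suc j) (m<n⇒m<1+n r<j) = refl
... | tri≈ r≮j refl _
  rewrite dec-true (r ≟ r) refl | dec-false (r <? r) r≮j | dec-true (r <? suc r) (n<1+n r) = refl
... | tri> _ r≢j j<r
  rewrite dec-false (r ≟ j) r≢j | dec-false (r <? j) (<⇒≯ j<r) | dec-false (r <? suc j) (<⇒≱ j<r ∘ s≤s⁻¹) = refl

∑-downFrom-𝟙[≟%] : ∀ n .{{_ : NonZero n}} r {j} → j ≤ n → ∑ (downFrom j) (λ y → 𝟙 (r ≟ y % n)) ≡ 𝟙 (r <? j)
∑-downFrom-𝟙[≟%] n r {zero}  _   = refl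
∑-downFrom-𝟙[≟%] n r {suc j} j<n = trans (cong₂ _+_ (cong (λ y → 𝟙 (r ≟ y)) (m<n⇒m%n≡m j<n))
                                                   (∑-downFrom-𝟙[≟%] n r (<⇒≤ j<n)))
                                         (𝟙[≟]+𝟙[<?]≡𝟙[<?suc] r j)

module _ (n : ℕ) .{{_ : NonZero n}} (k : ℕ) where

  InClass : ℕ → Subset n → Set
  InClass r S = ∣ S ∣ ≡ k × elemSum S % n ≡ r

  inClass? : ∀ r → Decidable (InClass r)
  inClass? r S = (∣ S ∣ ≟ k) ×-dec (elemSum S % n ≟ r)

  -- Indexed by ℕ rather than by residues, so that shifting a class is just an addition.
  classSize : ℕ → ℕ
  classSize y = ∑ (allSubsets n) (𝟙 ∘ inClass? (y % n))

  length-B≡classSize : ∀ x → length (B n k x) ≡ classSize (toℕ x)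
  length-B≡classSize x = trans (length-filter≡∑𝟙 (inClass? (toℕ x)) (allSubsets n))
                               (cong (λ r → ∑ (allSubsets n) (𝟙 ∘ inClass? r)) (sym (m<n⇒m%n≡m (toℕ<n x))))

  classSize-+*n : ∀ y j → classSize (y + j * n) ≡ classSize y
  classSize-+*n y j = cong (λ r → ∑ (allSubsets n) (𝟙 ∘ inClass? r)) ([m+kn]%n≡m%n y j n)

  ∑-classSize : ∑ (downFrom n) classSize ≡ n C k
  ∑-classSize = begin
    ∑ (downFrom n) classSize
      ≡⟨ ∑-comm (downFrom n) (allSubsets n) (λ y → 𝟙 ∘ inClass? (y % n)) ⟩
    ∑ (allSubsets n) (λ S → ∑ (downFrom n) (λ y → 𝟙 (inClass? (y % n) S)))
      ≡⟨ ∑-cong (allSubsets n) fibre ⟩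
    ∑ (allSubsets n) (λ S → 𝟙 (∣ S ∣ ≟ k))
      ≡⟨ ∑𝟙[∣S∣≟k]≡nCk n k ⟩
    n C k ∎
    where
    open ≡-Reasoning
    fibre : ∀ S → ∑ (downFrom n) (λ y → 𝟙 (inClass? (y % n) S)) ≡ 𝟙 (∣ S ∣ ≟ k)
    fibre S = begin
      ∑ (downFrom n) (λ y → 𝟙 (inClass? (y % n) S))
        ≡⟨ ∑-cong (downFrom n) (λ y → 𝟙-×-dec (∣ S ∣ ≟ k) (elemSum S % n ≟ y % n)) ⟩
      ∑ (downFrom n) (λ y → 𝟙 (∣ S ∣ ≟ k) * 𝟙 (elemSum S % n ≟ y % n))
        ≡⟨ ∑-*ˡ (downFrom n) (𝟙 (∣ S ∣ ≟ k)) _ ⟩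
      𝟙 (∣ S ∣ ≟ k) * ∑ (downFrom n) (λ y → 𝟙 (elemSum S % n ≟ y % n))
        ≡⟨ cong (𝟙 (∣ S ∣ ≟ k) *_) (∑-downFrom-𝟙[≟%] n (elemSum S % n) ≤-refl) ⟩
      𝟙 (∣ S ∣ ≟ k) * 𝟙 (elemSum S % n <? n)
        ≡⟨ cong (λ b → 𝟙 (∣ S ∣ ≟ k) * bit b) (dec-true (elemSum S % n <? n) (m%n<n (elemSum S) n)) ⟩
      𝟙 (∣ S ∣ ≟ k) * 1
        ≡⟨ *-identityʳ _ ⟩
      𝟙 (∣ S ∣ ≟ k) ∎

module _ (m k : ℕ) where

  inClass-rotate : ∀ y b (v : Subset m) →
                   InClass (suc m) k ((y + k) % suc m) (b ∷ v) ⇔ InClass (suc m) k (y % suc m) (v ∷ʳ b)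
  inClass-rotate y b v = mk⇔
    (λ (∣b∷v∣≡k , sum≡y+k) → let ∣v∷ʳb∣≡k = trans (sym ∣b∷v∣≡∣v∷ʳb∣) ∣b∷v∣≡k in
        ∣v∷ʳb∣≡k , +-cancelʳ-mod (elemSum (v ∷ʳ b)) y k m (trans (rotate ∣v∷ʳb∣≡k) sum≡y+k))
    (λ (∣v∷ʳb∣≡k , sum≡y) →
        trans ∣b∷v∣≡∣v∷ʳb∣ ∣v∷ʳb∣≡k , trans (sym (rotate ∣v∷ʳb∣≡k)) (+-congʳ-mod (elemSum (v ∷ʳ b)) y k (suc m) sum≡y))
    where
    ∣b∷v∣≡∣v∷ʳb∣ : ∣ b ∷ v ∣ ≡ ∣ v ∷ʳ b ∣
    ∣b∷v∣≡∣v∷ʳb∣ = trans (∣∷∣ b v) (sym (∣∷ʳ∣ v b))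
    rotate : ∣ v ∷ʳ b ∣ ≡ k → (elemSum (v ∷ʳ b) + k) % suc m ≡ elemSum (b ∷ v) % suc m
    rotate ∣v∷ʳb∣≡k = begin
      (elemSum (v ∷ʳ b) + k) % suc m                ≡⟨ cong (λ c → (elemSum (v ∷ʳ b) + c) % suc m) ∣v∷ʳb∣≡k ⟨
      (elemSum (v ∷ʳ b) + ∣ v ∷ʳ b ∣) % suc m       ≡⟨ cong (_% suc m) (elemSum-rotate v b) ⟩
      (elemSum (b ∷ v) + bit b * suc m) % suc m     ≡⟨ [m+kn]%n≡m%n (elemSum (b ∷ v)) (bit b) (suc m) ⟩
      elemSum (b ∷ v) % suc m                       ∎
      where open ≡-Reasoning

  classSize-+k : ∀ y → classSize (suc m) k (y + k) ≡ classSize (suc m) k y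
  classSize-+k y = begin
    classSize (suc m) k (y + k)
      ≡⟨ ∑-allSubsets-∷ m (𝟙 ∘ inClass? (suc m) k ((y + k) % suc m)) ⟩
    ∑ (allSubsets m) (λ v → 𝟙 (inClass? (suc m) k ((y + k) % suc m) (outside ∷ v))) +
    ∑ (allSubsets m) (λ v → 𝟙 (inClass? (suc m) k ((y + k) % suc m) (inside ∷ v)))
      ≡⟨ cong₂ _+_ (∑-cong (allSubsets m) (rotated outside)) (∑-cong (allSubsets m) (rotated inside)) ⟩
    ∑ (allSubsets m) (λ v → 𝟙 (inClass? (suc m) k (y % suc m) (v ∷ʳ outside))) +
    ∑ (allSubsets m) (λ v → 𝟙 (inClass? (suc m) k (y % suc m) (v ∷ʳ inside)))
      ≡⟨ ∑-+ (allSubsets m) _ _ ⟨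
    ∑ (allSubsets m) (λ v → 𝟙 (inClass? (suc m) k (y % suc m) (v ∷ʳ outside)) +
                            𝟙 (inClass? (suc m) k (y % suc m) (v ∷ʳ inside)))
      ≡⟨ ∑-allSubsets-∷ʳ m (𝟙 ∘ inClass? (suc m) k (y % suc m)) ⟨
    classSize (suc m) k y ∎
    where
    open ≡-Reasoning
    rotated : ∀ b v → 𝟙 (inClass? (suc m) k ((y + k) % suc m) (b ∷ v)) ≡ 𝟙 (inClass? (suc m) k (y % suc m) (v ∷ʳ b))
    rotated b v = 𝟙-⇔ (inClass? (suc m) k ((y + k) % suc m) (b ∷ v)) (inClass? (suc m) k (y % suc m) (v ∷ʳ b))
                        (inClass-rotate y b v)

  classSize-+*k : ∀ y j → classSize (suc m) k (y + j * k) ≡ classSize (suc m) k y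
  classSize-+*k y zero    = cong (classSize (suc m) k) (+-identityʳ y)
  classSize-+*k y (suc j) = begin
    classSize (suc m) k (y + (k + j * k))   ≡⟨ cong (classSize (suc m) k) (trans (cong (y +_) (+-comm k (j * k))) (sym (+-assoc y (j * k) k))) ⟩
    classSize (suc m) k (y + j * k + k)     ≡⟨ classSize-+k (y + j * k) ⟩
    classSize (suc m) k (y + j * k)         ≡⟨ classSize-+*k y j ⟩
    classSize (suc m) k y                   ∎
    where open ≡-Reasoning

  classSize-suc : Coprime k (suc m) → ∀ y → classSize (suc m) k (suc y) ≡ classSize (suc m) k y
  classSize-suc k⊥n y with coprime-Bézout k⊥n
  ... | Bézout.+- i j 1+j*n≡i*k = begin
    classSize (suc m) k (suc y)                ≡⟨ classSize-+*n (suc m) k (suc y) j ⟨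
    classSize (suc m) k (suc y + j * suc m)    ≡⟨ cong (classSize (suc m) k) (trans (sym (+-suc y _)) (cong (y +_) 1+j*n≡i*k)) ⟩
    classSize (suc m) k (y + i * k)            ≡⟨ classSize-+*k y i ⟩
    classSize (suc m) k y                      ∎
    where open ≡-Reasoning
  ... | Bézout.-+ i j 1+i*k≡j*n = begin
    classSize (suc m) k (suc y)                ≡⟨ classSize-+*k (suc y) i ⟨
    classSize (suc m) k (suc y + i * k)        ≡⟨ cong (classSize (suc m) k) (trans (sym (+-suc y _)) (cong (y +_) 1+i*k≡j*n)) ⟩
    classSize (suc m) k (y + j * suc m)        ≡⟨ classSize-+*n (suc m) k y j ⟩
    classSize (suc m) k y                      ∎
    where open ≡-Reasoning

  classSize-const : Coprime k (suc m) → ∀ y → classSize (suc m) k y ≡ classSize (suc m) k 0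
  classSize-const k⊥n zero    = refl
  classSize-const k⊥n (suc y) = trans (classSize-suc k⊥n y) (classSize-const k⊥n y)

  n*classSize≡nCk : Coprime k (suc m) → suc m * classSize (suc m) k 0 ≡ suc m C k
  n*classSize≡nCk k⊥n = begin
    suc m * classSize (suc m) k 0                    ≡⟨ cong (_* classSize (suc m) k 0) (length-downFrom (suc m)) ⟨
    length (downFrom (suc m)) * classSize (suc m) k 0 ≡⟨ ∑-const (downFrom (suc m)) (classSize (suc m) k 0) ⟨
    ∑ (downFrom (suc m)) (λ _ → classSize (suc m) k 0) ≡⟨ ∑-cong (downFrom (suc m)) (classSize-const k⊥n) ⟨
    ∑ (downFrom (suc m)) (classSize (suc m) k)        ≡⟨ ∑-classSize (suc m) k ⟩
    suc m C k                                         ∎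
    where open ≡-Reasoning

∑-#containing≡∑∣∣ : ∀ {n} (L : List (Subset n)) → ∑ (allFin n) (λ g → length (filter (g ∈?_) L)) ≡ ∑ L ∣_∣
∑-#containing≡∑∣∣ {n} L = begin
  ∑ (allFin n) (λ g → length (filter (g ∈?_) L))   ≡⟨ ∑-cong (allFin n) (λ g → length-filter≡∑𝟙 (g ∈?_) L) ⟩
  ∑ (allFin n) (λ g → ∑ L (λ S → 𝟙 (g ∈? S)))      ≡⟨ ∑-comm (allFin n) L (λ g S → 𝟙 (g ∈? S)) ⟩
  ∑ L (λ S → ∑ (allFin n) (λ g → 𝟙 (g ∈? S)))      ≡⟨ ∑-cong L ∣S∣≡∑𝟙[i∈S] ⟨
  ∑ L ∣_∣                                          ∎
  where open ≡-Reasoning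

∑-replication≡k*∣B∣ : ∀ n .{{_ : NonZero n}} k x → ∑ (allFin n) (replication n k x) ≡ k * length (B n k x)
∑-replication≡k*∣B∣ n k x = begin
  ∑ (allFin n) (replication n k x)   ≡⟨ ∑-#containing≡∑∣∣ (B n k x) ⟩
  ∑ (B n k x) ∣_∣                     ≡⟨ ∑-All≡ (All.map proj₁ (all-filter (inClass? n k (toℕ x)) (allSubsets n))) ⟩
  length (B n k x) * k                ≡⟨ *-comm (length (B n k x)) k ⟩
  k * length (B n k x)                ∎
  where open ≡-Reasoning

1-design⇒n*r≡k*∣B∣ : ∀ n .{{_ : NonZero n}} k x → Is1Design n k x → ∀ g → n * replication n k x g ≡ k * length (B n k x)
1-design⇒n*r≡k*∣B∣ n k x design g = begin
  n * replication n k x g                  ≡⟨ cong (_* replication n k x g) (length-tabulate {n = n} id) ⟨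
  length (allFin n) * replication n k x g  ≡⟨ ∑-const (allFin n) (replication n k x g) ⟨
  ∑ (allFin n) (λ _ → replication n k x g) ≡⟨ ∑-cong (allFin n) (λ h → design h g) ⟨
  ∑ (allFin n) (replication n k x)         ≡⟨ ∑-replication≡k*∣B∣ n k x ⟩
  k * length (B n k x)                     ∎
  where open ≡-Reasoning

1-design⇒n*n∣nCk : ∀ m k x → Coprime k (suc m) → Is1Design (suc m) k x → suc m * suc m ∣ suc m C k
1-design⇒n*n∣nCk m k x k⊥n design = subst (n * n ∣_) n*∣B∣≡nCk (*-monoʳ-∣ n n∣∣B∣)
  where
  n = suc m
  n∣∣B∣ : n ∣ length (B n k x)
  n∣∣B∣ = coprime-divisor (coprime-sym k⊥n)
            (divides (replication n k x zero) (trans (sym (1-design⇒n*r≡k*∣B∣ n k x design zero)) (*-comm n _)))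
  n*∣B∣≡nCk : n * length (B n k x) ≡ n C k
  n*∣B∣≡nCk = trans (cong (n *_) (trans (length-B≡classSize n k x) (classSize-const m k k⊥n (toℕ x))))
                    (n*classSize≡nCk m k k⊥n)

-- Prime powers dividing binomial coefficients

pred[n]<n : ∀ n .{{_ : NonZero n}} → pred n < n
pred[n]<n n = ≤-reflexive (suc-pred n)

module _ {p : ℕ} (p-prime : Prime p) where

  private instance
    p≢0 : NonZero p
    p≢0 = prime⇒nonZero p-prime

  1<p : 1 < p
  1<p = nonTrivial⇒n>1 p {{prime⇒nonTrivial p-prime}}

  ∤1 : ¬ p ∣ 1
  ∤1 p∣1 = <⇒≢ 1<p (sym (∣1⇒≡1 p∣1))

  ∤-* : ∀ {m n} → ¬ p ∣ m → ¬ p ∣ n → ¬ p ∣ m * n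
  ∤-* p∤m p∤n p∣mn = [ p∤m , p∤n ]′ (euclidsLemma _ _ p-prime p∣mn)

  ∤-digit : ∀ {r} q → 0 < r → r < p → ¬ p ∣ r + q * p
  ∤-digit {r} q 0<r r<p p∣r+qp =
    <⇒≱ r<p (∣⇒≤ {{>-nonZero 0<r}} (∣m+n∣m⇒∣n (subst (p ∣_) (+-comm r (q * p)) p∣r+qp) (n∣m*n q)))

  -- Legendre: the multiples p, 2p, …, qp among 1, …, r + qp contribute p ^ q * q !; all other factors are prime to p.
  factorial-digits : ∀ q {r} → r < p → ∃[ u ] ¬ p ∣ u × (r + q * p) ! ≡ p ^ q * q ! * u
  factorial-digits zero {zero} _ = 1 , ∤1 , refl
  factorial-digits q {suc r} 1+r<p with factorial-digits q {r} (<⇒≤ 1+r<p)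
  ... | u , p∤u , eq = (suc r + q * p) * u , ∤-* (∤-digit q z<s 1+r<p) p∤u , (begin
    (suc r + q * p) * (r + q * p) !     ≡⟨ cong ((suc r + q * p) *_) eq ⟩
    (suc r + q * p) * (p ^ q * q ! * u) ≡⟨ shuffle (suc r + q * p) (p ^ q) (q !) u ⟩
    p ^ q * q ! * ((suc r + q * p) * u) ∎)
    where
    open ≡-Reasoning
    shuffle : ∀ x P F u → x * (P * F * u) ≡ P * F * (x * u)
    shuffle = solve-∀
  factorial-digits (suc q) {zero} _ with factorial-digits q {pred p} (pred[n]<n p)
  ... | u , p∤u , eq = u , p∤u , (begin
    (p + q * p) !                           ≡⟨ cong (λ x → (x + q * p) !) (sym (suc-pred p)) ⟩
    (suc (pred p) + q * p) !                ≡⟨ cong (λ x → (x + q * p) * (pred p + q * p) !) (suc-pred p) ⟩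
    (p + q * p) * (pred p + q * p) !        ≡⟨ cong ((p + q * p) *_) eq ⟩
    (p + q * p) * (p ^ q * q ! * u)         ≡⟨ shuffle p q (p ^ q) (q !) u ⟩
    p * p ^ q * (suc q * q !) * u ∎)
    where
    open ≡-Reasoning
    shuffle : ∀ p q P F u → (p + q * p) * (P * F * u) ≡ p * P * ((1 + q) * F) * u
    shuffle = solve-∀

  factorial-split : ∀ m → ∃[ u ] ¬ p ∣ u × m ! ≡ p ^ (m / p) * (m / p) ! * u
  factorial-split m with factorial-digits (m / p) (m%n<n m p)
  ... | u , p∤u , eq = u , p∤u , trans (cong _! (m≡m%n+[m/n]*n m p)) eq

  carry : ℕ → ℕ → ℕ → ℕ
  carry c A K = (c + A % p + K % p) / p

  carry≤1 : ∀ {c} A K → c ≤ 1 → carry c A K ≤ 1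
  carry≤1 {c} A K c≤1 = <⇒≤pred (m<n*o⇒m/o<n {n = 2} (+-mono-≤-< c+a₀≤p k₀<p))
    where
    c+a₀≤p : c + A % p ≤ p
    c+a₀≤p = ≤-trans (+-monoˡ-≤ (A % p) c≤1) (m%n<n A p)
    k₀<p : K % p < p + 0
    k₀<p = subst (K % p <_) (sym (+-identityʳ p)) (m%n<n K p)

  +-digits : ∀ c A K → c + A + K ≡ (c + A % p + K % p) % p + (carry c A K + A / p + K / p) * p
  +-digits c A K = begin
    c + A + K
      ≡⟨ cong₂ (λ x y → c + x + y) (m≡m%n+[m/n]*n A p) (m≡m%n+[m/n]*n K p) ⟩
    c + (A % p + A / p * p) + (K % p + K / p * p)
      ≡⟨ regroup c (A % p) (A / p) (K % p) (K / p) p ⟩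
    (c + A % p + K % p) + (A / p + K / p) * p
      ≡⟨ cong (_+ (A / p + K / p) * p) (m≡m%n+[m/n]*n (c + A % p + K % p) p) ⟩
    (c + A % p + K % p) % p + carry c A K * p + (A / p + K / p) * p
      ≡⟨ regroup′ ((c + A % p + K % p) % p) (carry c A K) (A / p) (K / p) p ⟩
    (c + A % p + K % p) % p + (carry c A K + A / p + K / p) * p ∎
    where
    open ≡-Reasoning
    regroup : ∀ c a₀ A′ k₀ K′ p → c + (a₀ + A′ * p) + (k₀ + K′ * p) ≡ c + a₀ + k₀ + (A′ + K′) * p
    regroup = solve-∀
    regroup′ : ∀ r e A′ K′ p → r + e * p + (A′ + K′) * p ≡ r + (e + A′ + K′) * p
    regroup′ = solve-∀

  -- Kummer's step: up to factors prime to p, dividing A and K by p turns (c + A + K)! / (A! K!)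
  -- into p ^ e (e + A/p + K/p)! / ((A/p)! (K/p)!), where e is the carry of the lowest base-p digits.
  descend : ∀ {c A K W} a → p ^ a * (A ! * K !) ∣ (c + A + K) ! * W →
            ∃[ u ] ¬ p ∣ u × (p ^ a * ((A / p) ! * (K / p) !) ∣
                              p ^ carry c A K * ((carry c A K + A / p + K / p) ! * (u * W)))
  descend {c} {A} {K} {W} a h
    with factorial-split A | factorial-split K
       | factorial-digits (carry c A K + A / p + K / p) (m%n<n (c + A % p + K % p) p)
  ... | uA , _ , eqA | uK , _ , eqK | uN , p∤uN , eqN =
    uN , p∤uN , ∣-trans (m∣m*n (uA * uK)) (*-cancelˡ-∣ (p ^ (A′ + K′)) {{m^n≢0 p (A′ + K′)}} (subst₂ _∣_ lhs rhs h))
    where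
    open ≡-Reasoning
    A′ = A / p
    K′ = K / p
    e  = carry c A K
    N′ = e + A′ + K′
    lhs : p ^ a * (A ! * K !) ≡ p ^ (A′ + K′) * (p ^ a * (A′ ! * K′ !) * (uA * uK))
    lhs = begin
      p ^ a * (A ! * K !)                                    ≡⟨ cong₂ (λ x y → p ^ a * (x * y)) eqA eqK ⟩
      p ^ a * (p ^ A′ * A′ ! * uA * (p ^ K′ * K′ ! * uK))    ≡⟨ shuffle (p ^ a) (p ^ A′) (p ^ K′) (A′ !) (K′ !) uA uK ⟩
      p ^ A′ * p ^ K′ * (p ^ a * (A′ ! * K′ !) * (uA * uK))  ≡⟨ cong (_* (p ^ a * (A′ ! * K′ !) * (uA * uK))) (^-distribˡ-+-* p A′ K′) ⟨
      p ^ (A′ + K′) * (p ^ a * (A′ ! * K′ !) * (uA * uK))    ∎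
      where
      shuffle : ∀ Q P₁ P₂ F₁ F₂ u₁ u₂ → Q * (P₁ * F₁ * u₁ * (P₂ * F₂ * u₂)) ≡ P₁ * P₂ * (Q * (F₁ * F₂) * (u₁ * u₂))
      shuffle = solve-∀
    rhs : (c + A + K) ! * W ≡ p ^ (A′ + K′) * (p ^ e * (N′ ! * (uN * W)))
    rhs = begin
      (c + A + K) ! * W                              ≡⟨ cong (λ x → x ! * W) (+-digits c A K) ⟩
      ((c + A % p + K % p) % p + N′ * p) ! * W       ≡⟨ cong (_* W) eqN ⟩
      p ^ N′ * N′ ! * uN * W                          ≡⟨ cong (λ x → p ^ x * N′ ! * uN * W) (+-assoc e A′ K′) ⟩
      p ^ (e + (A′ + K′)) * N′ ! * uN * W             ≡⟨ cong (λ x → x * N′ ! * uN * W) (^-distribˡ-+-* p e (A′ + K′)) ⟩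
      p ^ e * p ^ (A′ + K′) * N′ ! * uN * W           ≡⟨ shuffle (p ^ e) (p ^ (A′ + K′)) (N′ !) uN W ⟩
      p ^ (A′ + K′) * (p ^ e * (N′ ! * (uN * W)))     ∎
      where
      shuffle : ∀ E P F u W → E * P * F * u * W ≡ P * (E * (F * (u * W)))
      shuffle = solve-∀

  lift-bound : ∀ {a e N′ N X Y} → e ≤ 1 → e ≤ N′ → N′ * p ≤ N →
               (∀ b → p ^ b * X ∣ Y → b ≡ 0 ⊎ p ^ b ≤ N′) →
               p ^ a * X ∣ p ^ e * Y → a ≡ 0 ⊎ p ^ a ≤ N
  lift-bound {a} {zero} {N′} {X = X} {Y} _ _ N′p≤N ih h =
    map₂ (λ pᵃ≤N′ → ≤-trans pᵃ≤N′ (≤-trans (m≤m*n N′ p) N′p≤N)) (ih a (subst (p ^ a * X ∣_) (*-identityˡ Y) h))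
  lift-bound {zero} {suc zero} _ _ _ _ _ = inj₁ refl
  lift-bound {suc a} {suc zero} {N′} {N} {X} {Y} _ 1≤N′ N′p≤N ih h =
    inj₂ (≤-trans (*-monoʳ-≤ p pᵃ≤N′) (subst (_≤ N) (*-comm N′ p) N′p≤N))
    where
    pᵃ≤N′ : p ^ a ≤ N′
    pᵃ≤N′ = [ (λ { refl → 1≤N′ }) , id ]′
              (ih a (*-cancelˡ-∣ p (subst₂ _∣_ (*-assoc p (p ^ a) X) (cong (_* Y) (*-identityʳ p)) h)))
  lift-bound {e = 2+ _} (s≤s ()) _ _ _ _

  q<r+q*p : ∀ {r q} → 0 < r + q * p → q < r + q * p
  q<r+q*p {r} {zero}  0<r = 0<r
  q<r+q*p {r} {suc q} _   = <-≤-trans (m<m*n (suc q) p 1<p) (m≤n+m (suc q * p) r)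

  -- W collects the factors prime to p dropped so far. Each step divides N by p and loses at most one
  -- factor p (the carry), so p ^ a cannot outgrow N.
  prime-power-bound : ∀ {N} → Acc _<_ N → ∀ {c A K W} a → c ≤ 1 → c + A + K ≡ N → ¬ p ∣ W →
              p ^ a * (A ! * K !) ∣ N ! * W → a ≡ 0 ⊎ p ^ a ≤ N
  prime-power-bound {zero} _ zero _ _ _ _ = inj₁ refl
  prime-power-bound {zero} _ {W = W} (suc a) _ _ p∤W h =
    ⊥-elim (p∤W (subst (p ∣_) (*-identityˡ W) (∣-trans (∣m⇒∣m*n _ (m∣m*n (p ^ a))) h)))
  prime-power-bound {suc N₀} (acc rec) {c} {A} {K} {W} a c≤1 N≡ p∤W h =
    let u , p∤u , h′ = descend a (subst (λ M → p ^ a * (A ! * K !) ∣ M ! * W) (sym N≡) h) in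
    lift-bound (carry≤1 A K c≤1) (≤-trans (m≤m+n e A′) (m≤m+n (e + A′) K′)) N′p≤N
      (λ b → prime-power-bound (rec N′<N) b (carry≤1 A K c≤1) refl (∤-* p∤u p∤W)) h′
    where
    A′ = A / p
    K′ = K / p
    e  = carry c A K
    N′ = e + A′ + K′
    digits≡N : (c + A % p + K % p) % p + N′ * p ≡ suc N₀
    digits≡N = trans (sym (+-digits c A K)) N≡
    N′p≤N : N′ * p ≤ suc N₀
    N′p≤N = subst (N′ * p ≤_) digits≡N (m≤n+m (N′ * p) _)
    N′<N : N′ < suc N₀
    N′<N = subst (N′ <_) digits≡N (q<r+q*p (subst (0 <_) (sym digits≡N) z<s))

  nCk*[k!*[n∸k]!]≡n! : ∀ {n k} → k ≤ n → (n C k) * (k ! * (n ∸ k) !) ≡ n !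
  nCk*[k!*[n∸k]!]≡n! {n} {k} k≤n =
    trans (cong (_* (k ! * (n ∸ k) !)) (nCk≡n!/k![n-k]! k≤n)) (m/n*n≡m {{k !* (n ∸ k) !≢0}} (k![n∸k]!∣n! k≤n))

  prime-power∣nCk⇒≤n : ∀ {n k a} .{{_ : NonZero n}} → k ≤ n → p ^ a ∣ n C k → p ^ a ≤ n
  prime-power∣nCk⇒≤n {n} {k} {a} k≤n pᵃ∣nCk =
    [ (λ { refl → >-nonZero⁻¹ n }) , id ]′ (prime-power-bound (<-wellFounded n) {0} {k} {n ∸ k} a z≤n (m+[n∸m]≡n k≤n) ∤1 pᵃk![n∸k]!∣n!)
    where
    pᵃk![n∸k]!∣n! : p ^ a * (k ! * (n ∸ k) !) ∣ n ! * 1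
    pᵃk![n∸k]!∣n! = subst (p ^ a * (k ! * (n ∸ k) !) ∣_) (trans (nCk*[k!*[n∸k]!]≡n! k≤n) (sym (*-identityʳ (n !))))
                      (*-monoˡ-∣ (k ! * (n ∸ k) !) pᵃ∣nCk)

proposition3 : (n : ℕ) .{{_ : NonZero n}} (x : Fin n) (k : ℕ) →
    1 ≤ k → k ≤ n →
    (q : ℕ) → Prime q → q ∣ n → (∀ p → Prime p → p ∣ n → p ≤ q) →
    (t : ℕ) → q ^ t ∣ n → ¬ (q ^ suc t ∣ n) →
    n ≤ q ^ (2 * t) ∸ 1 → gcd k n ≡ 1 →
    ¬ Is1Design n k x
proposition3 (suc m) x k _ k≤n q q-prime _ _ t qᵗ∣n _ n≤q²ᵗ∸1 gcd[k,n]≡1 design =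
  <-irrefl refl (≤-<-trans (≤-trans q²ᵗ≤n n≤q²ᵗ∸1) (pred[n]<n (q ^ (2 * t)) {{m^n≢0 q (2 * t) {{prime⇒nonZero q-prime}}}}))
  where
  q²ᵗ≡qᵗ*qᵗ : q ^ (2 * t) ≡ q ^ t * q ^ t
  q²ᵗ≡qᵗ*qᵗ = trans (^-distribˡ-+-* q t (t + 0)) (cong (λ s → q ^ t * q ^ s) (+-identityʳ t))
  q²ᵗ∣nCk : q ^ (2 * t) ∣ suc m C k
  q²ᵗ∣nCk = subst (_∣ suc m C k) (sym q²ᵗ≡qᵗ*qᵗ)
              (∣-trans (*-pres-∣ qᵗ∣n qᵗ∣n) (1-design⇒n*n∣nCk m k x (gcd≡1⇒coprime gcd[k,n]≡1) design))
  q²ᵗ≤n : q ^ (2 * t) ≤ suc m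
  q²ᵗ≤n = prime-power∣nCk⇒≤n q-prime {a = 2 * t} k≤n q²ᵗ∣nCk
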